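{- For all finite digraphs $G,H,H'$ and every $\xi\in\mathcal{H}(G,H)$, we have $\#\Theta_{G,H'}(\xi)=\#\mathcal{S}(\mathcal{G}(\xi),H')$, where $\Theta_{G,H'}(\xi)=\{\zeta\in\mathcal{H}(G,H'):\mathcal{G}(\zeta)=\mathcal{G}(\xi)\}$.
   Context: Digraphs $G=(V(G),A(G))$: finite non-empty $V(G)$, $A(G)\subseteq V(G)\times V(G)$; loops are arcs $vv$, proper arcs $vw$ with $v\ne w$; $G^*$ is $G$ without loops. $\mathcal{H}(G,H)$: homomorphisms (maps with $\xi(v)\xi(w)\in A(H)$ for $vw\in A(G)$); $\mathcal{S}(G,H)=\mathcal{H}(G,H)\cap\mathcal{H}(G^*,H^*)$: strict homomorphisms (mapping proper arcs to proper arcs). $v,w$ adjacent if $vw$ or $wv$ is an arc. For $X\subseteq V(G)$, $v\in X$, $\gamma_X(v)$ = set of $w\in X$ equal to $v$ or joined to $v$ by a sequence in $X$ of consecutively adjacent vertices; $\Gamma_\xi(v)=\gamma_{\xi^{ -1}(\xi(v))}(v)$. For $\xi\in\mathcal{H}(G,H)$, $\mathcal{G}(\xi)$ is the digraph with vertex set $\{\Gamma_\xi(v): v\in V(G)\}$ and arcs $(\mathfrak{a},\mathfrak{b})$ whenever some $a\in\mathfrak{a}$, $b\in\mathfrak{b}$ satisfy $ab\in A(G)$. -}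

module Defs where

open import Data.Nat using (ℕ; zero; suc; _<_; _≤_; s≤s; z≤n)
open import Data.Nat.Properties using (m<1+n⇒m<n∨m≡n; n<1+n; <-trans; _≟_)
open import Data.Fin using (Fin; toℕ)
open import Data.Fin.Properties using (toℕ-injective; toℕ<n; any?) renaming (_≟_ to _≟ᶠ_)
open import Data.Fin.Subset using (Subset; _∈_; inside; outside)
open import Data.Fin.Subset.Properties using (_∈?_)
open import Data.Bool using (Bool; T; _∧_; not)
open import Data.Bool.Properties using (T?) renaming (_≟_ to _≟ᵇ_)
open import Data.Vec using (Vec; lookup; tabulate)
open import Data.Vec.Properties using (≡-dec)
open import Data.List using (List; length; map; deduplicate)
import Data.List as L
open import Data.List.Relation.Unary.Unique.Propositional using (Unique)
import Data.List.Membership.Propositional as LM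
open import Data.Product using (Σ; ∃; _×_; _,_; proj₁; proj₂)
open import Data.Sum using (_⊎_; inj₁; inj₂)
open import Data.Empty using (⊥)
open import Function.Bundles using (_⇔_; mk⇔)
open import Relation.Nullary using (Dec; yes; no; ¬_; does; _×-dec_; _⊎-dec_)
open import Relation.Nullary.Decidable using (map′; ⌊_⌋)
open import Relation.Binary.PropositionalEquality using (_≡_; _≢_; refl; subst; sym; trans)

-- A finite digraph is given (up to relabelling of its
-- vertices) by a number of vertices  size ≥ 1  (vertex set Fin size)
-- and an arc relation, given as a Bool-valued matrix (loops allowed).

record Digraph : Set where
  field
    size     : ℕ
    nonEmpty : 1 ≤ size
    arc      : Fin size → Fin size → Bool

open Digraph public

V : Digraph → Set
V G = Fin (size G)

Arc : (G : Digraph) → V G → V G → Set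
Arc G v w = T (arc G v w)

_* : Digraph → Digraph
G * = record { size = size G ; nonEmpty = nonEmpty G
             ; arc = λ v w → arc G v w ∧ not ⌊ v ≟ᶠ w ⌋ }

-- Maps V(G) → V(H), represented as the vector of images (so that two maps
-- are equal iff they are equal as functions).
Map : Digraph → Digraph → Set
Map G H = Vec (V H) (size G)

IsHom : (G H : Digraph) → Map G H → Set
IsHom G H ξ = ∀ v w → Arc G v w → Arc H (lookup ξ v) (lookup ξ w)

IsStrict : (G H : Digraph) → Map G H → Set
IsStrict G H ξ = IsHom G H ξ × IsHom (G *) (H *) ξ

Adjacent : (G : Digraph) → V G → V G → Set
Adjacent G v w = Arc G v w ⊎ Arc G w v

module Conn {n : ℕ} (X : Fin n → Set) (Adj : Fin n → Fin n → Set) where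

  -- Seq u w : a sequence u = x₀, x₁, …, x_k = w (k ≥ 0) of consecutively
  -- adjacent vertices with x₁,…,x_k ∈ X (x₀ = u is in X by assumption
  -- wherever this is used).
  data Seq : Fin n → Fin n → Set where
    []  : ∀ {u} → Seq u u
    _∷_ : ∀ {u x w} → Adj u x × X x → Seq x w → Seq u w

  γ : Fin n → Fin n → Set
  γ v w = X w × Seq v w

  -- auxiliary: decidability of γ (Floyd–Warshall style argument)
  _++ˢ_ : ∀ {u x w} → Seq u x → Seq x w → Seq u w
  [] ++ˢ t = t
  (a ∷ s) ++ˢ t = a ∷ (s ++ˢ t)

  data Tr (k : ℕ) : Fin n → Fin n → Set where
    tr-refl : ∀ {u} → Tr k u u
    tr-edge : ∀ {u w} → Adj u w → X w → Tr k u w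
    tr-via  : ∀ {u w} (x : Fin n) → toℕ x < k → Tr k u x → Tr k x w → Tr k u w

  Mid : ℕ → Fin n → Fin n → Set
  Mid k u w = Σ (Fin n) λ y → toℕ y ≡ k × Tr k u y × Tr k y w

  tr-mono : ∀ {k u w} → Tr k u w → Tr (suc k) u w
  tr-mono tr-refl = tr-refl
  tr-mono (tr-edge a x) = tr-edge a x
  tr-mono (tr-via x lt p q) = tr-via x (<-trans lt (n<1+n _)) (tr-mono p) (tr-mono q)

  private
    toK : ∀ {k u x} → toℕ x ≡ k → Tr k u x ⊎ Mid k u x → Tr k u x
    toK e (inj₁ p) = p
    toK e (inj₂ (y , e' , p1 , p2)) = subst (Tr _ _) (toℕ-injective (trans e' (sym e))) p1

    fromK : ∀ {k x w} → toℕ x ≡ k → Tr k x w ⊎ Mid k x w → Tr k x w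
    fromK e (inj₁ q) = q
    fromK e (inj₂ (y , e' , q1 , q2)) = subst (λ z → Tr _ z _) (toℕ-injective (trans e' (sym e))) q2

  split : ∀ {k u w} → Tr (suc k) u w → Tr k u w ⊎ Mid k u w
  split tr-refl = inj₁ tr-refl
  split (tr-edge a x) = inj₁ (tr-edge a x)
  split {k} (tr-via x lt p q) with m<1+n⇒m<n∨m≡n lt | split p | split q
  ... | inj₂ e | sp | sq = inj₂ (x , e , toK e sp , fromK e sq)
  ... | inj₁ l | inj₁ p' | inj₁ q' = inj₁ (tr-via x l p' q')
  ... | inj₁ l | inj₁ p' | inj₂ (y , e , q1 , q2) = inj₂ (y , e , tr-via x l p' q1 , q2)
  ... | inj₁ l | inj₂ (y , e , p1 , p2) | inj₁ q' = inj₂ (y , e , p1 , tr-via x l p2 q')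
  ... | inj₁ l | inj₂ (y , e , p1 , p2) | inj₂ (y' , e' , q1 , q2) =
    inj₂ (y , e , p1 , subst (λ z → Tr k z _) (toℕ-injective (trans e' (sym e))) q2)

  tr0 : ∀ {u w} → Tr 0 u w → u ≡ w ⊎ (Adj u w × X w)
  tr0 tr-refl = inj₁ refl
  tr0 (tr-edge a x) = inj₂ (a , x)
  tr0 (tr-via x () p q)

  module _ (X? : ∀ x → Dec (X x)) (Adj? : ∀ u w → Dec (Adj u w)) where

    tr? : ∀ k u w → Dec (Tr k u w)
    tr? zero u w with u ≟ᶠ w | Adj? u w ×-dec X? w
    ... | yes refl | _ = yes tr-refl
    ... | no _ | yes (a , x) = yes (tr-edge a x)
    ... | no ne | no nax = no λ t → [ ne , nax ] (tr0 t)
      where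
        [_,_] : ∀ {A B : Set} → (A → ⊥) → (B → ⊥) → A ⊎ B → ⊥
        [ f , g ] (inj₁ a) = f a
        [ f , g ] (inj₂ b) = g b
    tr? (suc k) u w with tr? k u w
    ... | yes t = yes (tr-mono t)
    ... | no nt with any? (λ y → (toℕ y ≟ k) ×-dec (tr? k u y ×-dec tr? k y w))
    ...   | yes (y , e , p , q) =
            yes (tr-via y (subst (_< suc k) (sym e) (n<1+n k)) (tr-mono p) (tr-mono q))
    ...   | no nm = no λ t → helper (split t)
      where
        helper : Tr k u w ⊎ Mid k u w → ⊥
        helper (inj₁ t) = nt t
        helper (inj₂ m) = nm m

    private
      tr→seq : ∀ {k u w} → Tr k u w → Seq u w
      tr→seq tr-refl = []
      tr→seq (tr-edge a x) = (a , x) ∷ []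
      tr→seq (tr-via x _ p q) = tr→seq p ++ˢ tr→seq q

      seq→tr : ∀ {u w} → Seq u w → Tr n u w
      seq→tr [] = tr-refl
      seq→tr (_∷_ {x = x} (a , xx) s) = tr-via x (toℕ<n x) (tr-edge a xx) (seq→tr s)

    seq? : ∀ u w → Dec (Seq u w)
    seq? u w = map′ tr→seq seq→tr (tr? n u w)

    γ? : ∀ v w → Dec (γ v w)
    γ? v w = X? w ×-dec seq? v w

module _ (G H : Digraph) (ξ : Map G H) where

  Fibre : V G → V G → Set
  Fibre v x = lookup ξ x ≡ lookup ξ v

  InΓ : V G → V G → Set
  InΓ v w = Conn.γ (Fibre v) (Adjacent G) v w

  InΓ? : ∀ v w → Dec (InΓ v w)
  InΓ? v = Conn.γ? (Fibre v) (Adjacent G)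
             (λ x → lookup ξ x ≟ᶠ lookup ξ v)
             (λ u w → T? (arc G u w) ⊎-dec T? (arc G w u)) v

  Γ : V G → Subset (size G)
  Γ v = tabulate λ w → does (InΓ? v w)

record SDigraph (n : ℕ) : Set where
  field
    verts : List (Subset n)          -- the vertex set (listed without repetition)
    sarc  : Subset n → Subset n → Bool

open SDigraph public

_≐_ : ∀ {n} → SDigraph n → SDigraph n → Set
D ≐ E = (∀ S → (S LM.∈ verts D) ⇔ (S LM.∈ verts E))
      × (∀ 𝔞 𝔟 → 𝔞 LM.∈ verts D → 𝔟 LM.∈ verts D → T (sarc D 𝔞 𝔟) ⇔ T (sarc E 𝔞 𝔟))

BlockArc : (G : Digraph) → Subset (size G) → Subset (size G) → Set
BlockArc G 𝔞 𝔟 = ∃ λ a → ∃ λ b → a ∈ 𝔞 × b ∈ 𝔟 × Arc G a b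

blockArc : (G : Digraph) → Subset (size G) → Subset (size G) → Bool
blockArc G 𝔞 𝔟 = does (any? λ a → any? λ b → (a ∈? 𝔞) ×-dec ((b ∈? 𝔟) ×-dec T? (arc G a b)))

_≟ˢ_ : ∀ {n} (S S′ : Subset n) → Dec (S ≡ S′)
_≟ˢ_ = ≡-dec _≟ᵇ_

𝓖 : (G H : Digraph) → Map G H → SDigraph (size G)
𝓖 G H ξ = record
  { verts = deduplicate _≟ˢ_ (map (Γ G H ξ) (L.allFin (size G)))
  ; sarc  = blockArc G }

nonEmpty𝓖 : (G H : Digraph) (ξ : Map G H) → 1 ≤ length (verts (𝓖 G H ξ))
nonEmpty𝓖 G H ξ with size G | nonEmpty G | Γ G H ξ
... | suc m | _ | g = s≤s z≤n

𝓖D : (G H : Digraph) → Map G H → Digraph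
𝓖D G H ξ = record
  { size = length (verts D)
  ; nonEmpty = nonEmpty𝓖 G H ξ
  ; arc = λ i j → sarc D (L.lookup (verts D) i) (L.lookup (verts D) j) }
  where D = 𝓖 G H ξ

HasSize : {A : Set} → (A → Set) → ℕ → Set
HasSize {A} P k = Σ (List A) λ l → Unique l × length l ≡ k × (∀ x → (x LM.∈ l) ⇔ P x)

Θ : (G H H' : Digraph) → Map G H → Map G H' → Set
Θ G H H' ξ ζ = IsHom G H' ζ × (𝓖 G H' ζ ≐ 𝓖 G H ξ)

-- Let π : V(G) → V(𝓖(ξ)) send v to its block Γ_ξ(v).  Then σ ↦ σ ∘ π is a
-- bijection from 𝓢(𝓖(ξ),H′) onto Θ_{G,H′}(ξ).  It is injective because π is
-- onto.  If σ is strict, σ ∘ π is constant on every block, and it takes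
-- different values at adjacent vertices of different blocks (these blocks are
-- joined by a proper arc of 𝓖(ξ)); so the components of the fibres of σ ∘ π
-- are exactly the blocks of ξ, i.e. 𝓖(σ ∘ π) = 𝓖(ξ).  Conversely, if
-- 𝓖(ζ) = 𝓖(ξ) then Γ_ζ = Γ_ξ, so ζ is constant on blocks and factors as σ ∘ π,
-- and σ is strict: equal values at the ends of an arc ab put a and b in one
-- component of a fibre of ζ, hence in one block.
module Submission where

open import Defs
open import Data.Nat using (ℕ; zero; suc)
open import Data.Fin using (Fin)
open import Data.Fin.Properties using (all?; any?) renaming (_≟_ to _≟ᶠ_)
open import Data.Fin.Subset using (Subset; _∈_)
open import Data.Fin.Subset.Properties using (_∈?_)
open import Data.Bool using (true; T)
open import Data.Bool.Properties using (T?; T-≡)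
open import Data.Unit using (tt)
open import Data.Empty using (⊥-elim)
open import Data.Product using (Σ; ∃; ∃₂; _×_; _,_; proj₁; proj₂)
open import Data.Sum using (inj₁; inj₂; swap)
open import Data.Vec as Vec using (Vec; lookup; tabulate)
open import Data.Vec.Properties
  using (lookup∘tabulate; tabulate∘lookup; tabulate-cong; []=⇒lookup; lookup⇒[]=; ∷-injective)
open import Data.List as List using (List; length; map; allFin; filter; cartesianProductWith)
open import Data.List.Properties using (map-cong; length-map)
open import Data.List.Relation.Unary.Any using (index)
open import Data.List.Relation.Unary.Any.Properties using (lookup-index)
import Data.List.Relation.Unary.All as All
open import Data.List.Relation.Unary.AllPairs using ([]; _∷_)
open import Data.List.Relation.Unary.Unique.Propositional using (Unique)
open import Data.List.Relation.Unary.Unique.Propositional.Properties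
  using (map⁺; filter⁺; allFin⁺; cartesianProductWith⁺)
open import Data.List.Relation.Unary.Unique.DecPropositional.Properties using (deduplicate-!)
open import Data.List.Membership.Propositional using () renaming (_∈_ to _∈ₗ_)
open import Data.List.Membership.Propositional.Properties
  using (∈-map⁺; ∈-map⁻; ∈-allFin; ∈-lookup; ∈-filter⁺; ∈-filter⁻; ∈-cartesianProductWith⁺;
         ∈-deduplicate⁺; ∈-deduplicate⁻)
open import Function using (_∘_; id)
open import Function.Bundles using (_⇔_; mk⇔; module Equivalence)
open Equivalence using (to; from)
open import Relation.Unary using (Decidable)
open import Relation.Nullary using (Dec; does; yes; no; _×-dec_; _→-dec_)
open import Relation.Nullary.Decidable using (isYes≗does; toWitness; fromWitness; does-⇔)
open import Relation.Binary.PropositionalEquality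
  using (_≡_; _≢_; _≗_; refl; sym; trans; cong; subst; subst₂; module ≡-Reasoning)
open Conn using (Seq; []; _∷_)

lookup-injective : ∀ {A : Set} {xs : List A} → Unique xs →
                   ∀ i j → List.lookup xs i ≡ List.lookup xs j → i ≡ j
lookup-injective {xs = _ List.∷ _} _ Fin.zero Fin.zero _ = refl
lookup-injective {xs = _ List.∷ _} (x∉ ∷ _) Fin.zero (Fin.suc j) e =
  ⊥-elim (All.lookup x∉ (∈-lookup j) e)
lookup-injective {xs = _ List.∷ _} (x∉ ∷ _) (Fin.suc i) Fin.zero e =
  ⊥-elim (All.lookup x∉ (∈-lookup i) (sym e))
lookup-injective {xs = _ List.∷ _} (_ ∷ u) (Fin.suc i) (Fin.suc j) e =
  cong Fin.suc (lookup-injective u i j e)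

lookup-extensional : ∀ {A : Set} {n} {u w : Vec A n} → (∀ i → lookup u i ≡ lookup w i) → u ≡ w
lookup-extensional {u = u} {w} u≗w = begin
  u                   ≡⟨ tabulate∘lookup u ⟨
  tabulate (lookup u) ≡⟨ tabulate-cong u≗w ⟩
  tabulate (lookup w) ≡⟨ tabulate∘lookup w ⟩
  w                   ∎
  where open ≡-Reasoning

HasSize-image : ∀ {A B : Set} {P : A → Set} {Q : B → Set} {f : A → B} {k : ℕ} →
                (∀ {x y} → f x ≡ f y → x ≡ y) → (∀ y → Q y ⇔ ∃ λ x → P x × f x ≡ y) →
                HasSize P k → HasSize Q k
HasSize-image {P = P} {Q} {f} f-injective Q⇔image (l , l-unique , refl , l-lists-P) =
  map f l , map⁺ f-injective l-unique , length-map f l , λ y → mk⇔ (image⇒Q y) (Q⇒image y)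
  where
    image⇒Q : ∀ y → y ∈ₗ map f l → Q y
    image⇒Q y y∈ with ∈-map⁻ f y∈
    ... | x , x∈l , refl = from (Q⇔image y) (x , to (l-lists-P x) x∈l , refl)
    Q⇒image : ∀ y → Q y → y ∈ₗ map f l
    Q⇒image y Qy with to (Q⇔image y) Qy
    ... | x , Px , refl = ∈-map⁺ f (from (l-lists-P x) Px)

allVecs : (m n : ℕ) → List (Vec (Fin m) n)
allVecs m zero    = List.[ Vec.[] ]
allVecs m (suc n) = cartesianProductWith Vec._∷_ (allFin m) (allVecs m n)

∈-allVecs : ∀ {m n} (v : Vec (Fin m) n) → v ∈ₗ allVecs m n
∈-allVecs Vec.[]       = ∈-lookup Fin.zero
∈-allVecs (x Vec.∷ v) = ∈-cartesianProductWith⁺ Vec._∷_ (∈-allFin x) (∈-allVecs v)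

allVecs-unique : ∀ m n → Unique (allVecs m n)
allVecs-unique m zero    = All.[] ∷ []
allVecs-unique m (suc n) = cartesianProductWith⁺ Vec._∷_ ∷-injective (allFin⁺ m) (allVecs-unique m n)

Decidable⇒HasSize : ∀ {m n} {P : Vec (Fin m) n → Set} → Decidable P → ∃ (HasSize P)
Decidable⇒HasSize {m} {n} P? =
  length l , l , filter⁺ P? (allVecs-unique m n) , refl ,
  λ v → mk⇔ (proj₂ ∘ ∈-filter⁻ P? {xs = allVecs m n}) (∈-filter⁺ P? (∈-allVecs v))
  where l = filter P? (allVecs m n)

T-does⇔ : ∀ {P : Set} (P? : Dec P) → T (does P?) ⇔ P
T-does⇔ P? = mk⇔ (toWitness ∘ subst T (sym (isYes≗does P?))) (subst T (isYes≗does P?) ∘ fromWitness)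

T-blockArc⇔ : (G : Digraph) (𝔞 𝔟 : Subset (size G)) → T (blockArc G 𝔞 𝔟) ⇔ BlockArc G 𝔞 𝔟
T-blockArc⇔ G 𝔞 𝔟 =
  T-does⇔ (any? λ a → any? λ b → (a ∈? 𝔞) ×-dec ((b ∈? 𝔟) ×-dec T? (arc G a b)))

isHom? : (X Y : Digraph) → Decidable (IsHom X Y)
isHom? X Y σ = all? λ v → all? λ w → T? (arc X v w) →-dec T? (arc Y (lookup σ v) (lookup σ w))

isStrict? : (X Y : Digraph) → Decidable (IsStrict X Y)
isStrict? X Y σ = isHom? X Y σ ×-dec isHom? (X *) (Y *) σ

arc*⁺ : (X : Digraph) {i j : V X} → Arc X i j → i ≢ j → Arc (X *) i j
arc*⁺ X {i} {j} a i≢j with arc X i j | i ≟ᶠ j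
... | true | yes i≡j = i≢j i≡j
... | true | no _    = tt

arc*⁻ : (X : Digraph) {i j : V X} → Arc (X *) i j → Arc X i j × i ≢ j
arc*⁻ X {i} {j} a with arc X i j | i ≟ᶠ j
... | true | no i≢j = tt , i≢j

strict⁺ : (X Y : Digraph) {σ : Map X Y} → IsHom X Y σ →
          (∀ {i j} → Arc X i j → lookup σ i ≡ lookup σ j → i ≡ j) → IsStrict X Y σ
strict⁺ X Y hom separates = hom , λ i j a* →
  let a , i≢j = arc*⁻ X a* in arc*⁺ Y (hom i j a) (i≢j ∘ separates a)

strict-separates : (X Y : Digraph) {σ : Map X Y} → IsStrict X Y σ →
                   ∀ {i j} → Arc X i j → i ≢ j → lookup σ i ≢ lookup σ j
strict-separates X Y (_ , hom*) a i≢j = proj₂ (arc*⁻ Y (hom* _ _ (arc*⁺ X a i≢j)))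

module _ {n : ℕ} {Adj : Fin n → Fin n → Set} where

  _++ˢ_ : ∀ {X : Fin n → Set} {u x w} → Seq X Adj u x → Seq X Adj x w → Seq X Adj u w
  _++ˢ_ = Conn._++ˢ_ _ _

  Seq-map : ∀ {X Y : Fin n → Set} → (∀ {x} → X x → Y x) → ∀ {u w} → Seq X Adj u w → Seq Y Adj u w
  Seq-map f []             = []
  Seq-map f ((a , x) ∷ s) = (a , f x) ∷ Seq-map f s

  Seq-reverse : ∀ {X : Fin n → Set} → (∀ {u w} → Adj u w → Adj w u) →
                ∀ {u w} → X u → Seq X Adj u w → Seq X Adj w u
  Seq-reverse adj-sym Xu []              = []
  Seq-reverse adj-sym Xu ((a , Xx) ∷ s) = Seq-reverse adj-sym Xx s ++ˢ ((adj-sym a , Xu) ∷ [])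

module Components (G H : Digraph) (ξ : Map G H) where

  InΓ-refl : ∀ v → InΓ G H ξ v v
  InΓ-refl v = refl , []

  InΓ-sym : ∀ {v w} → InΓ G H ξ v w → InΓ G H ξ w v
  InΓ-sym (e , s) = sym e , Seq-map (λ ex → trans ex (sym e)) (Seq-reverse swap refl s)

  InΓ-trans : ∀ {v w u} → InΓ G H ξ v w → InΓ G H ξ w u → InΓ G H ξ v u
  InΓ-trans (e , s) (e′ , t) = trans e′ e , s ++ˢ Seq-map (λ ex → trans ex e) t

  InΓ-extend : ∀ {v u x} → InΓ G H ξ v u → Adjacent G u x → lookup ξ x ≡ lookup ξ v → InΓ G H ξ v x
  InΓ-extend (_ , s) a e = e , s ++ˢ ((a , e) ∷ [])

  InΓ-adjacent : ∀ {a b} → Adjacent G a b → lookup ξ b ≡ lookup ξ a → InΓ G H ξ a b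
  InΓ-adjacent = InΓ-extend (InΓ-refl _)

  InΓ-ind : ∀ {v} (P : V G → Set) → P v →
            (∀ {u x} → P u → Adjacent G u x → lookup ξ x ≡ lookup ξ v → P x) →
            ∀ {w} → InΓ G H ξ v w → P w
  InΓ-ind {v} P Pv step (_ , s) = go Pv s
    where
      go : ∀ {u w} → P u → Seq (Fibre G H ξ v) (Adjacent G) u w → P w
      go Pu []             = Pu
      go Pu ((a , e) ∷ s) = go (step Pu a e) s

  ∈Γ⇔InΓ : ∀ {v w} → w ∈ Γ G H ξ v ⇔ InΓ G H ξ v w
  ∈Γ⇔InΓ {v} {w} = mk⇔
    (λ w∈ → to (T-does⇔ (InΓ? G H ξ v w)) (from T-≡ (trans (sym lookup-Γ) ([]=⇒lookup w∈))))
    (λ p → lookup⇒[]= w _ (trans lookup-Γ (to T-≡ (from (T-does⇔ (InΓ? G H ξ v w)) p))))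
    where
      lookup-Γ : lookup (Γ G H ξ v) w ≡ does (InΓ? G H ξ v w)
      lookup-Γ = lookup∘tabulate _ w

  Γ≡⇔InΓ : ∀ {v w} → Γ G H ξ v ≡ Γ G H ξ w ⇔ InΓ G H ξ v w
  Γ≡⇔InΓ {v} {w} = mk⇔
    (λ Γv≡Γw → to ∈Γ⇔InΓ (subst (w ∈_) (sym Γv≡Γw) (from ∈Γ⇔InΓ (InΓ-refl w))))
    (λ p → tabulate-cong λ u →
      does-⇔ (mk⇔ (InΓ-trans (InΓ-sym p)) (InΓ-trans p)) (InΓ? G H ξ v u) (InΓ? G H ξ w u))

  Γ∈verts : ∀ v → Γ G H ξ v ∈ₗ verts (𝓖 G H ξ)
  Γ∈verts v = ∈-deduplicate⁺ _≟ˢ_ (∈-map⁺ (Γ G H ξ) (∈-allFin v))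

  verts⇒Γ : ∀ {S} → S ∈ₗ verts (𝓖 G H ξ) → ∃ λ v → S ≡ Γ G H ξ v
  verts⇒Γ S∈ with ∈-map⁻ (Γ G H ξ) (∈-deduplicate⁻ _≟ˢ_ (map (Γ G H ξ) (allFin _)) S∈)
  ... | v , _ , S≡Γv = v , S≡Γv

module Comparison (G H H′ : Digraph) (ξ : Map G H) (ζ : Map G H′) where

  private
    module X = Components G H ξ
    module Z = Components G H′ ζ

  InΓ-⊆ : ∀ {v} → (∀ {w} → InΓ G H ξ v w → lookup ζ w ≡ lookup ζ v) →
          ∀ {w} → InΓ G H ξ v w → InΓ G H′ ζ v w
  InΓ-⊆ {v} ζ-constant = proj₂ ∘ X.InΓ-ind (λ u → InΓ G H ξ v u × InΓ G H′ ζ v u)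
    (X.InΓ-refl v , Z.InΓ-refl v)
    λ (pξ , pζ) a e → let pξ′ = X.InΓ-extend pξ a e in pξ′ , Z.InΓ-extend pζ a (ζ-constant pξ′)

  sameComponents⇒𝓖≐ : (∀ {v w} → InΓ G H′ ζ v w ⇔ InΓ G H ξ v w) → 𝓖 G H′ ζ ≐ 𝓖 G H ξ
  sameComponents⇒𝓖≐ same = (λ S → mk⇔ (subst (S ∈ₗ_) verts≡) (subst (S ∈ₗ_) (sym verts≡)))
                          , (λ _ _ _ _ → mk⇔ id id)
    where
      Γ≗ : Γ G H′ ζ ≗ Γ G H ξ
      Γ≗ v = tabulate-cong λ w → does-⇔ same (InΓ? G H′ ζ v w) (InΓ? G H ξ v w)
      verts≡ : verts (𝓖 G H′ ζ) ≡ verts (𝓖 G H ξ)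
      verts≡ = cong (List.deduplicate _≟ˢ_) (map-cong Γ≗ (allFin _))

  𝓖≐⇒sameComponents : 𝓖 G H′ ζ ≐ 𝓖 G H ξ → ∀ {v w} → InΓ G H′ ζ v w ⇔ InΓ G H ξ v w
  𝓖≐⇒sameComponents (sameVerts , _) {v} {w} = mk⇔
    (λ p → to X.∈Γ⇔InΓ (subst (w ∈_) Γζ≡Γξ (from Z.∈Γ⇔InΓ p)))
    (λ p → to Z.∈Γ⇔InΓ (subst (w ∈_) (sym Γζ≡Γξ) (from X.∈Γ⇔InΓ p)))
    where
      -- Γ_ζ(v) is some block Γ_ξ(u) of ξ; as it contains v, that block is Γ_ξ(v).
      Γζ≡Γξ : Γ G H′ ζ v ≡ Γ G H ξ v
      Γζ≡Γξ with X.verts⇒Γ (to (sameVerts _) (Z.Γ∈verts v))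
      ... | u , Γζv≡Γξu = trans Γζv≡Γξu (from X.Γ≡⇔InΓ
        (to X.∈Γ⇔InΓ (subst (v ∈_) Γζv≡Γξu (from Z.∈Γ⇔InΓ (Z.InΓ-refl v)))))

module Blocks (G H : Digraph) (ξ : Map G H) where

  open Components G H ξ

  𝔅 : List (Subset (size G))
  𝔅 = verts (𝓖 G H ξ)

  D : Digraph
  D = 𝓖D G H ξ

  block : V G → V D
  block v = index (Γ∈verts v)

  lookup-block : ∀ v → List.lookup 𝔅 (block v) ≡ Γ G H ξ v
  lookup-block v = sym (lookup-index (Γ∈verts v))

  rep : V D → V G
  rep i = proj₁ (verts⇒Γ (∈-lookup {xs = 𝔅} i))

  lookup-rep : ∀ i → List.lookup 𝔅 i ≡ Γ G H ξ (rep i)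
  lookup-rep i = proj₂ (verts⇒Γ (∈-lookup {xs = 𝔅} i))

  lookup-𝔅-injective : ∀ i j → List.lookup 𝔅 i ≡ List.lookup 𝔅 j → i ≡ j
  lookup-𝔅-injective = lookup-injective (deduplicate-! _≟ˢ_ (map (Γ G H ξ) (allFin _)))

  block-rep : ∀ i → block (rep i) ≡ i
  block-rep i = lookup-𝔅-injective _ _ (trans (lookup-block (rep i)) (sym (lookup-rep i)))

  InΓ⇒block≡ : ∀ {v w} → InΓ G H ξ v w → block v ≡ block w
  InΓ⇒block≡ {v} {w} p = lookup-𝔅-injective _ _
    (trans (lookup-block v) (trans (from Γ≡⇔InΓ p) (sym (lookup-block w))))

  block≡⇒InΓ : ∀ {v w} → block v ≡ block w → InΓ G H ξ v w
  block≡⇒InΓ {v} {w} e = to Γ≡⇔InΓ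
    (trans (sym (lookup-block v)) (trans (cong (List.lookup 𝔅) e) (lookup-block w)))

  ∈⇒block≡ : ∀ {i a} → a ∈ List.lookup 𝔅 i → block a ≡ i
  ∈⇒block≡ {i} a∈ =
    trans (sym (InΓ⇒block≡ (to ∈Γ⇔InΓ (subst (_ ∈_) (lookup-rep i) a∈)))) (block-rep i)

  arc⁺ : ∀ {a b} → Arc G a b → Arc D (block a) (block b)
  arc⁺ {a} {b} ab = from (T-blockArc⇔ G _ _) (a , b , ∈own a , ∈own b , ab)
    where
      ∈own : ∀ v → v ∈ List.lookup 𝔅 (block v)
      ∈own v = subst (v ∈_) (sym (lookup-block v)) (from ∈Γ⇔InΓ (InΓ-refl v))

  arc⁻ : ∀ {i j} → Arc D i j → ∃₂ λ a b → block a ≡ i × block b ≡ j × Arc G a b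
  arc⁻ t with to (T-blockArc⇔ G _ _) t
  ... | a , b , a∈ , b∈ , ab = a , b , ∈⇒block≡ a∈ , ∈⇒block≡ b∈ , ab

module Correspondence (G H H′ : Digraph) (ξ : Map G H) where

  open Components G H ξ
  open Blocks G H ξ
  open Comparison G H H′ ξ

  lift : Map D H′ → Map G H′
  lift σ = tabulate (lookup σ ∘ block)

  lookup-lift : ∀ σ v → lookup (lift σ) v ≡ lookup σ (block v)
  lookup-lift σ = lookup∘tabulate _

  lift-injective : ∀ {σ σ′} → lift σ ≡ lift σ′ → σ ≡ σ′
  lift-injective {σ} {σ′} e = lookup-extensional λ i → begin
    lookup σ i                 ≡⟨ cong (lookup σ) (block-rep i) ⟨
    lookup σ (block (rep i))   ≡⟨ lookup-lift σ (rep i) ⟨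
    lookup (lift σ) (rep i)    ≡⟨ cong (λ τ → lookup τ (rep i)) e ⟩
    lookup (lift σ′) (rep i)   ≡⟨ lookup-lift σ′ (rep i) ⟩
    lookup σ′ (block (rep i))  ≡⟨ cong (lookup σ′) (block-rep i) ⟩
    lookup σ′ i                ∎
    where open ≡-Reasoning

  module _ {σ : Map D H′} (σ-strict : IsStrict D H′ σ) where

    lift-hom : IsHom G H′ (lift σ)
    lift-hom a b ab = subst₂ (Arc H′) (sym (lookup-lift σ a)) (sym (lookup-lift σ b))
                        (proj₁ σ-strict _ _ (arc⁺ ab))

    lift-constant : ∀ {v w} → InΓ G H ξ v w → lookup (lift σ) w ≡ lookup (lift σ) v
    lift-constant {v} {w} p =
      trans (lookup-lift σ w) (trans (cong (lookup σ) (sym (InΓ⇒block≡ p))) (sym (lookup-lift σ v)))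

    lift-separates : ∀ {u x} → Adjacent G u x → block u ≢ block x → lookup (lift σ) u ≢ lookup (lift σ) x
    lift-separates {u} {x} (inj₁ ux) ne e = strict-separates D H′ {σ} σ-strict (arc⁺ ux) ne
      (trans (sym (lookup-lift σ u)) (trans e (lookup-lift σ x)))
    lift-separates {u} {x} (inj₂ xu) ne e = strict-separates D H′ {σ} σ-strict (arc⁺ xu) (ne ∘ sym)
      (trans (sym (lookup-lift σ x)) (trans (sym e) (lookup-lift σ u)))

    lift-sameComponents : ∀ {v w} → InΓ G H′ (lift σ) v w ⇔ InΓ G H ξ v w
    lift-sameComponents {v} = mk⇔
      (Components.InΓ-ind G H′ (lift σ) (InΓ G H ξ v) (InΓ-refl v) closed)
      (InΓ-⊆ (lift σ) lift-constant)
      where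
        closed : ∀ {u x} → InΓ G H ξ v u → Adjacent G u x → lookup (lift σ) x ≡ lookup (lift σ) v →
                 InΓ G H ξ v x
        closed {u} {x} p a e with block u ≟ᶠ block x
        ... | yes same = InΓ-trans p (block≡⇒InΓ same)
        ... | no diff  = ⊥-elim (lift-separates a diff (trans (lift-constant p) (sym e)))

    lift-Θ : Θ G H H′ ξ (lift σ)
    lift-Θ = lift-hom , sameComponents⇒𝓖≐ (lift σ) lift-sameComponents

  descend : Map G H′ → Map D H′
  descend ζ = tabulate (lookup ζ ∘ rep)

  module _ {ζ : Map G H′} (ζ-Θ : Θ G H H′ ξ ζ) where

    private
      sameComponents : ∀ {v w} → InΓ G H′ ζ v w ⇔ InΓ G H ξ v w
      sameComponents = 𝓖≐⇒sameComponents ζ (proj₂ ζ-Θ)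

    lookup-descend : ∀ {v i} → block v ≡ i → lookup (descend ζ) i ≡ lookup ζ v
    lookup-descend {v} {i} v∈i = trans (lookup∘tabulate _ i)
      (proj₁ (from sameComponents (block≡⇒InΓ {v} {rep i} (trans v∈i (sym (block-rep i))))))

    lift-descend : lift (descend ζ) ≡ ζ
    lift-descend = lookup-extensional λ v → trans (lookup-lift (descend ζ) v) (lookup-descend refl)

    descend-strict : IsStrict D H′ (descend ζ)
    descend-strict = strict⁺ D H′ {descend ζ} hom separates
      where
        hom : IsHom D H′ (descend ζ)
        hom i j t =
          let a , b , a∈i , b∈j , ab = arc⁻ t
          in  subst₂ (Arc H′) (sym (lookup-descend a∈i)) (sym (lookup-descend b∈j)) (proj₁ ζ-Θ a b ab)
        separates : ∀ {i j} → Arc D i j → lookup (descend ζ) i ≡ lookup (descend ζ) j → i ≡ j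
        separates t e =
          let a , b , a∈i , b∈j , ab = arc⁻ t
              ζa≡ζb = trans (sym (lookup-descend a∈i)) (trans e (lookup-descend b∈j))
              a~b = to sameComponents (Components.InΓ-adjacent G H′ ζ (inj₁ ab) (sym ζa≡ζb))
          in  trans (sym a∈i) (trans (InΓ⇒block≡ a~b) b∈j)

  Θ⇔lift : ∀ ζ → Θ G H H′ ξ ζ ⇔ ∃ λ σ → IsStrict D H′ σ × lift σ ≡ ζ
  Θ⇔lift ζ = mk⇔ (λ θ → descend ζ , descend-strict {ζ} θ , lift-descend {ζ} θ)
                 (λ { (σ , σ-strict , refl) → lift-Θ {σ} σ-strict })

lemma3 : (G H H′ : Digraph) (ξ : Map G H) → IsHom G H ξ →
    Σ ℕ (λ k → HasSize (Θ G H H′ ξ) k × HasSize (IsStrict (𝓖D G H ξ) H′) k)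
lemma3 G H H′ ξ _ =
  let k , strictMaps = Decidable⇒HasSize (isStrict? (𝓖D G H ξ) H′)
  in  k , HasSize-image lift-injective Θ⇔lift strictMaps , strictMaps
  where open Correspondence G H H′ ξ
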